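{- Let $H$ be a $3$-partite $3$-graph, let $T$ be a set of $t$ vertices with $t \le \tau(H)$, and let $A$ be any one of the three parts of $H$. Then there exists a set $F \subseteq E(H)$ of $\tau(H) - t$ edges, each disjoint from $T$, such that any two distinct edges of $F$ intersect only inside $A$.
   Context: A $3$-graph is $3$-partite if its vertex set splits into three parts with every edge having exactly one vertex in each part. $\tau(H)$ is the minimum size of a set of vertices meeting every edge of $H$. -}

module Defs where

open import Data.Nat using (ℕ; _≤_)
open import Data.Fin using (Fin; zero; suc)
open import Data.Fin.Subset using (Subset; _∈_; _∉_; ∣_∣)
open import Data.Product using (_×_; Σ-syntax)
open import Data.Sum using (_⊎_)
open import Data.List using (List)
open import Data.List.Relation.Unary.All using (All)
import Data.List.Membership.Propositional as LM
open import Relation.Binary.PropositionalEquality using (_≡_; _≢_)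

-- An edge is a triple (x , y , z) with x in part 0, y in part 1, z in part 2;
-- it stands for the 3-set {x, y, z}.  Since the position of each vertex in
-- the triple is determined by its part, equality of triples is equality of
-- the corresponding 3-sets.
Edge : ℕ → Set
Edge n = Fin n × Fin n × Fin n

record Tripartite3Graph (n : ℕ) : Set where
  field
    part     : Fin n → Fin 3
    edges    : List (Edge n)
    partite  : All (λ e → part (Data.Product.proj₁ e) ≡ zero
                        × part (Data.Product.proj₁ (Data.Product.proj₂ e)) ≡ suc zero
                        × part (Data.Product.proj₂ (Data.Product.proj₂ e)) ≡ suc (suc zero))
                   edges
open Tripartite3Graph public

_∈ₑ_ : ∀ {n} → Fin n → Edge n → Set
v ∈ₑ (x Data.Product., y Data.Product., z) = v ≡ x ⊎ v ≡ y ⊎ v ≡ z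

Meets : ∀ {n} → Subset n → Edge n → Set
Meets S (x Data.Product., y Data.Product., z) = x ∈ S ⊎ y ∈ S ⊎ z ∈ S

DisjointFrom : ∀ {n} → Subset n → Edge n → Set
DisjointFrom S (x Data.Product., y Data.Product., z) = x ∉ S × y ∉ S × z ∉ S

IsCover : ∀ {n} → Tripartite3Graph n → Subset n → Set
IsCover H S = ∀ {e} → e LM.∈ edges H → Meets S e

IsTau : ∀ {n} → Tripartite3Graph n → ℕ → Set
IsTau H k = (Σ[ S ∈ Subset _ ] (IsCover H S × ∣ S ∣ ≡ k))
          × (∀ S → IsCover H S → k ≤ ∣ S ∣)

MeetOnlyIn : ∀ {n} → Tripartite3Graph n → Fin 3 → Edge n → Edge n → Set
MeetOnlyIn H A e f = ∀ v → v ∈ₑ e → v ∈ₑ f → part H v ≡ A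

-- Let E′ be the edges of H that miss T, and view each as the pair of its two vertices outside
-- the part A: this is a bipartite multigraph (the link of A).  Two edges meet only inside A
-- exactly when their pairs are disjoint, so F should be a matching of the link.  By König's
-- theorem the link has a matching F and a vertex cover C with |C| ≤ |F|; then T ∪ C covers H,
-- hence τ(H) ≤ t + |F|, and any τ(H) − t edges of F will do.  König's theorem is proved by
-- Rizzi's induction on the number of edges, with vertices of degree two contracted.
module Submission where

open import Defs
open import Data.Nat using (ℕ; zero; suc; _+_; _≤_; _<_; _∸_; z≤n; s≤s)
open import Data.Nat.Properties
open import Data.Fin using (Fin; zero; suc; punchIn; punchOut)
open import Data.Fin.Properties using (punchIn-punchOut) renaming (_≟_ to _≟ᶠ_)
open import Data.Fin.Subset using (Subset; ∣_∣; ⁅_⁆; _∪_; _-_; inside; outside)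
  renaming (_∈_ to _∈ₛ_; ⊥ to ∅)
open import Data.Fin.Subset.Properties
  using (∣⊥∣≡0; ∣⁅x⁆∣≡1; x∈⁅x⁆; x≢y⇒x∉⁅y⁆; x∈p∪q⁺; x∈p∧x∉q⇒x∈p─q; x∈p⇒∣p-x∣<∣p∣; p⊆p∪q)
  renaming (_∈?_ to _∈ₛ?_)
open import Data.Product using (_×_; _,_; proj₁; proj₂; Σ-syntax)
import Data.Product as Product
open import Data.Product.Properties using (≡-dec)
open import Data.Sum using (_⊎_; inj₁; inj₂)
import Data.Sum as Sum
open import Data.Empty using (⊥-elim)
open import Data.Vec using ([]; _∷_)
open import Data.List using (List; []; _∷_; length; filter; take; deduplicate)
open import Data.List.Properties using (length-filter; filter-notAll; length-take)
open import Data.List.Relation.Unary.All as All using (All; []; _∷_)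
import Data.List.Relation.Unary.All.Properties as Allₚ
open import Data.List.Relation.Unary.Any using (here; there; any?)
open import Data.List.Relation.Unary.AllPairs as AllPairs using (AllPairs; []; _∷_)
import Data.List.Relation.Unary.AllPairs.Properties as AllPairsₚ
open import Data.List.Relation.Unary.Unique.Propositional using (Unique)
import Data.List.Relation.Unary.Unique.Propositional.Properties as Uniqueₚ
open import Data.List.Relation.Unary.Unique.DecPropositional.Properties using (deduplicate-!)
open import Data.List.Relation.Binary.Subset.Propositional using (_⊆_)
open import Data.List.Membership.Propositional using (_∈_; _∉_; find; lose)
open import Data.List.Membership.Propositional.Properties
  using (∈-filter⁺; ∈-filter⁻; ∈-AllPairs₂; ∈-deduplicate⁺; ∈-deduplicate⁻)
open import Function using (_∘_)
open import Relation.Binary.Definitions using (DecidableEquality)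
open import Relation.Binary.PropositionalEquality
open import Relation.Nullary using (¬_; Dec; yes; no; ¬?)
open import Relation.Nullary.Decidable using (_×-dec_)

∣p∪q∣≤∣p∣+∣q∣ : ∀ {n} (p q : Subset n) → ∣ p ∪ q ∣ ≤ ∣ p ∣ + ∣ q ∣
∣p∪q∣≤∣p∣+∣q∣ []            []            = z≤n
∣p∪q∣≤∣p∣+∣q∣ (outside ∷ p) (outside ∷ q) = ∣p∪q∣≤∣p∣+∣q∣ p q
∣p∪q∣≤∣p∣+∣q∣ (outside ∷ p) (inside  ∷ q) =
  ≤-trans (s≤s (∣p∪q∣≤∣p∣+∣q∣ p q)) (≤-reflexive (sym (+-suc ∣ p ∣ ∣ q ∣)))
∣p∪q∣≤∣p∣+∣q∣ (inside  ∷ p) (outside ∷ q) = s≤s (∣p∪q∣≤∣p∣+∣q∣ p q)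
∣p∪q∣≤∣p∣+∣q∣ (inside  ∷ p) (inside  ∷ q) =
  s≤s (≤-trans (∣p∪q∣≤∣p∣+∣q∣ p q) (+-monoʳ-≤ ∣ p ∣ (n≤1+n ∣ q ∣)))

∣p∪⁅x⁆∣≤1+∣p∣ : ∀ {n} (p : Subset n) x → ∣ p ∪ ⁅ x ⁆ ∣ ≤ suc ∣ p ∣
∣p∪⁅x⁆∣≤1+∣p∣ p x = begin
  ∣ p ∪ ⁅ x ⁆ ∣     ≤⟨ ∣p∪q∣≤∣p∣+∣q∣ p ⁅ x ⁆ ⟩
  ∣ p ∣ + ∣ ⁅ x ⁆ ∣ ≡⟨ cong (∣ p ∣ +_) (∣⁅x⁆∣≡1 x) ⟩
  ∣ p ∣ + 1         ≡⟨ +-comm ∣ p ∣ 1 ⟩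
  suc ∣ p ∣         ∎
  where open ≤-Reasoning

x∈p⇒x∈p∪⁅y⁆ : ∀ {n} {x y : Fin n} {p} → x ∈ₛ p → x ∈ₛ p ∪ ⁅ y ⁆
x∈p⇒x∈p∪⁅y⁆ x∈p = x∈p∪q⁺ (inj₁ x∈p)

x∈p∪⁅x⁆ : ∀ {n} {x : Fin n} {p} → x ∈ₛ p ∪ ⁅ x ⁆
x∈p∪⁅x⁆ {x = x} = x∈p∪q⁺ (inj₂ (x∈⁅x⁆ x))

x∈p∧x≢y⇒x∈p-y : ∀ {n} {x y : Fin n} {p} → x ∈ₛ p → x ≢ y → x ∈ₛ p - y
x∈p∧x≢y⇒x∈p-y x∈p x≢y = x∈p∧x∉q⇒x∈p─q x∈p (x≢y⇒x∉⁅y⁆ x≢y)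

redirect : ∀ {n} → Fin n → Fin n → Fin n → Fin n
redirect w v y with y ≟ᶠ w
... | yes _ = v
... | no  _ = y

redirect-∈ : ∀ {n} {w v y : Fin n} {p} → redirect w v y ∈ₛ p → (y ≡ w × v ∈ₛ p) ⊎ y ∈ₛ p
redirect-∈ {w = w} {y = y} ∈p with y ≟ᶠ w
... | yes y≡w = inj₁ (y≡w , ∈p)
... | no  _   = inj₂ ∈p

redirect-onto : ∀ {n} {w v y : Fin n} → v ≢ w → y ≡ v ⊎ y ≡ w → redirect w v y ≡ v
redirect-onto {w = w} {y = y} v≢w y∈vw with y ≟ᶠ w
... | yes _ = refl
... | no y≢w with y∈vw
...   | inj₁ y≡v = y≡v
...   | inj₂ y≡w = ⊥-elim (y≢w y≡w)

filter-shrinks : ∀ {A : Set} {P : A → Set} (P? : ∀ x → Dec (P x)) {x xs} → x ∈ xs → ¬ P x →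
                 length (filter P? xs) < length xs
filter-shrinks P? x∈ ¬Px = filter-notAll P? _ (lose x∈ ¬Px)

module _ {E : Set} where

  Independent : ∀ {p q} → (E → Fin p) → (E → Fin q) → E → E → Set
  Independent l r e f = l e ≢ l f × r e ≢ r f

  IsMatching : ∀ {p q} → (E → Fin p) → (E → Fin q) → List E → Set
  IsMatching l r = AllPairs (Independent l r)

-- A bipartite multigraph is a list Es of edge names with endpoint maps l and r into the
-- left and right vertex sets; distinct names may have the same endpoints.
module Bipartite {E : Set} (_≟_ : DecidableEquality E) where

  open import Data.List.Membership.DecPropositional _≟_ using (_∈?_)

  private variable
    p q : ℕ
    l : E → Fin p
    r : E → Fin q
    e f g h : E
    Es M : List E

  independent-∈ : IsMatching l r M → e ∈ M → f ∈ M → e ≢ f → Independent l r e f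
  independent-∈ m e∈ f∈ e≢f with ∈-AllPairs₂ m e∈ f∈
  ... | inj₁ e≡f                = ⊥-elim (e≢f e≡f)
  ... | inj₂ (inj₁ indep)       = indep
  ... | inj₂ (inj₂ (dl , dr))   = ≢-sym dl , ≢-sym dr

  record Cover (l : E → Fin p) (r : E → Fin q) (Es : List E) : Set where
    constructor mkCover
    field
      coverˡ : Subset p
      coverʳ : Subset q
      covers : ∀ {e} → e ∈ Es → l e ∈ₛ coverˡ ⊎ r e ∈ₛ coverʳ

    size : ℕ
    size = ∣ coverˡ ∣ + ∣ coverʳ ∣

  open Cover

  record KönigCertificate (l : E → Fin p) (r : E → Fin q) (Es : List E) : Set where
    field
      matching    : List E
      matching⊆   : matching ⊆ Es
      isMatching  : IsMatching l r matching
      cover       : Cover l r Es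
      size≤length : size cover ≤ length matching

  open KönigCertificate

  Cover-swap : Cover r l Es → Cover l r Es
  Cover-swap (mkCover Y X cov) = mkCover X Y (Sum.swap ∘ cov)

  size-swap : (C : Cover r l Es) → size (Cover-swap C) ≡ size C
  size-swap (mkCover Y X _) = +-comm ∣ X ∣ ∣ Y ∣

  KönigCertificate-swap : KönigCertificate r l Es → KönigCertificate l r Es
  KönigCertificate-swap K = record
    { matching    = matching K
    ; matching⊆   = matching⊆ K
    ; isMatching  = AllPairs.map Product.swap (isMatching K)
    ; cover       = Cover-swap (cover K)
    ; size≤length = ≤-trans (≤-reflexive (size-swap (cover K))) (size≤length K)
    }

  removeˡ : (C : Cover l r M) → l e ∈ₛ coverˡ C → All (λ x → l x ≢ l e) M →
            Σ[ C′ ∈ Cover l r M ] size C′ < size C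
  removeˡ {l = l} {e = e} (mkCover X Y cov) le∈X fresh =
    mkCover (X - l e) Y cov′ , +-monoˡ-< ∣ Y ∣ (x∈p⇒∣p-x∣<∣p∣ le∈X)
    where
    cov′ : ∀ {x} → x ∈ _ → l x ∈ₛ X - l e ⊎ _
    cov′ x∈ = Sum.map₁ (λ lx∈X → x∈p∧x≢y⇒x∈p-y lx∈X (All.lookup fresh x∈)) (cov x∈)

  removeʳ : (C : Cover l r M) → r e ∈ₛ coverʳ C → All (λ x → r x ≢ r e) M →
            Σ[ C′ ∈ Cover l r M ] size C′ < size C
  removeʳ C re∈Y fresh with removeˡ (Cover-swap C) re∈Y fresh
  ... | C′ , smaller = Cover-swap C′ , subst₂ _<_ (sym (size-swap C′)) (size-swap C) smaller

  Cover-⊆ : Es ⊆ M → Cover l r M → Cover l r Es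
  Cover-⊆ Es⊆M (mkCover X Y cov) = mkCover X Y (cov ∘ Es⊆M)

  -- Weak duality: each edge of a matching needs its own cover vertex.
  matching≤cover : IsMatching l r M → (C : Cover l r M) → length M ≤ size C
  matching≤cover [] _ = z≤n
  matching≤cover (indep ∷ m) C with covers C (here refl)
  ... | inj₁ le∈X with removeˡ (Cover-⊆ there C) le∈X (All.map (≢-sym ∘ proj₁) indep)
  ...   | C′ , smaller = ≤-trans (s≤s (matching≤cover m C′)) smaller
  matching≤cover (indep ∷ m) C | inj₂ re∈Y
    with removeʳ (Cover-⊆ there C) re∈Y (All.map (≢-sym ∘ proj₂) indep)
  ...   | C′ , smaller = ≤-trans (s≤s (matching≤cover m C′)) smaller

  image : (E → Fin p) → List E → Subset p
  image l []       = ∅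
  image l (e ∷ Es) = image l Es ∪ ⁅ l e ⁆

  ∈-image : e ∈ Es → l e ∈ₛ image l Es
  ∈-image (here refl) = x∈p∪⁅x⁆
  ∈-image (there e∈)  = x∈p⇒x∈p∪⁅y⁆ (∈-image e∈)

  ∣image∣≤length : ∀ {p} (l : E → Fin p) Es → ∣ image l Es ∣ ≤ length Es
  ∣image∣≤length {p} l []       = ≤-reflexive (∣⊥∣≡0 p)
  ∣image∣≤length     l (e ∷ Es) = ≤-trans (∣p∪⁅x⁆∣≤1+∣p∣ (image l Es) (l e)) (s≤s (∣image∣≤length l Es))

  matching⇒certificate : ∀ {p q} {l : E → Fin p} {r : E → Fin q} {Es} →
                         IsMatching l r Es → KönigCertificate l r Es
  matching⇒certificate {q = q} {l} {Es = Es} m = record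
    { matching    = Es
    ; matching⊆   = λ e∈ → e∈
    ; isMatching  = m
    ; cover       = mkCover (image l Es) ∅ (inj₁ ∘ ∈-image)
    ; size≤length = begin
        ∣ image l Es ∣ + ∣ ∅ {q} ∣ ≡⟨ cong (∣ image l Es ∣ +_) (∣⊥∣≡0 q) ⟩
        ∣ image l Es ∣ + 0         ≡⟨ +-identityʳ _ ⟩
        ∣ image l Es ∣             ≤⟨ ∣image∣≤length l Es ⟩
        length Es                  ∎
    }
    where open ≤-Reasoning

  infixl 5 _∖_

  _∖_ : List E → E → List E
  Es ∖ h = filter (λ x → ¬? (x ≟ h)) Es

  ∈-∖⁺ : e ∈ Es → e ≢ h → e ∈ Es ∖ h
  ∈-∖⁺ = ∈-filter⁺ _

  ∈-∖⁻ : e ∈ Es ∖ h → e ∈ Es × e ≢ h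
  ∈-∖⁻ = ∈-filter⁻ _

  deleteʳ : (E → Fin q) → Fin q → List E → List E
  deleteʳ r v = filter (λ x → ¬? (r x ≟ᶠ v))

  ∈-deleteʳ⁻ : ∀ {v} → e ∈ deleteʳ r v Es → e ∈ Es × r e ≢ v
  ∈-deleteʳ⁻ {Es = Es} = ∈-filter⁻ _ {xs = Es}

  certificate-∖ : (K : KönigCertificate l r (Es ∖ h)) →
                  l h ∈ₛ coverˡ (cover K) ⊎ r h ∈ₛ coverʳ (cover K) → KönigCertificate l r Es
  certificate-∖ {l = l} {r = r} {Es = Es} {h = h} K h-covered = record
    { matching    = matching K
    ; matching⊆   = proj₁ ∘ ∈-∖⁻ ∘ matching⊆ K
    ; isMatching  = isMatching K
    ; cover       = mkCover (coverˡ (cover K)) (coverʳ (cover K)) covers-Es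
    ; size≤length = size≤length K
    }
    where
    covers-Es : ∀ {x} → x ∈ Es → l x ∈ₛ coverˡ (cover K) ⊎ r x ∈ₛ coverʳ (cover K)
    covers-Es {x} x∈ with x ≟ h
    ... | yes refl = h-covered
    ... | no  x≢h  = covers (cover K) (∈-∖⁺ x∈ x≢h)

  Cover-deleteʳ : ∀ {v} → (C : Cover l r (deleteʳ r v Es)) →
                  Σ[ C′ ∈ Cover l r Es ] size C′ ≤ suc (size C)
  Cover-deleteʳ {r = r} {v = v} (mkCover X Y cov) =
    mkCover X (Y ∪ ⁅ v ⁆) covers-Es ,
    ≤-trans (+-monoʳ-≤ ∣ X ∣ (∣p∪⁅x⁆∣≤1+∣p∣ Y v)) (≤-reflexive (+-suc ∣ X ∣ ∣ Y ∣))
    where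
    covers-Es : ∀ {x} → x ∈ _ → _ ⊎ r x ∈ₛ Y ∪ ⁅ v ⁆
    covers-Es {x} x∈ with r x ≟ᶠ v
    ... | yes refl = inj₂ x∈p∪⁅x⁆
    ... | no  rx≢v = Sum.map₂ x∈p⇒x∈p∪⁅y⁆ (cov (∈-filter⁺ _ x∈ rx≢v))

  -- If M₂ beats M₁, the cover of the graph without r e plus r e is small
  -- enough.  Otherwise the cover of Es ∖ h cannot contain r e: removing it would leave a
  -- cover of M₁ (which avoids r e and h) smaller than M₁.  So it contains l e = l h.
  rizzi : e ∈ Es → h ≢ e → l h ≡ l e →
          (K₁ : KönigCertificate l r (deleteʳ r (r e) Es)) → h ∉ matching K₁ →
          KönigCertificate l r (Es ∖ h) → KönigCertificate l r Es
  rizzi {e = e} {Es = Es} {h = h} {l = l} {r = r} e∈ h≢e lh≡le K₁ h∉M₁ K₂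
    with suc (length (matching K₁)) ≤? length (matching K₂)
  ... | yes M₁<M₂ =
    let C , ∣C∣≤1+∣C₁∣ = Cover-deleteʳ {Es = Es} (cover K₁) in record
    { matching    = matching K₂
    ; matching⊆   = proj₁ ∘ ∈-∖⁻ ∘ matching⊆ K₂
    ; isMatching  = isMatching K₂
    ; cover       = C
    ; size≤length = ≤-trans ∣C∣≤1+∣C₁∣ (≤-trans (s≤s (size≤length K₁)) M₁<M₂)
    }
  ... | no M₁≮M₂ with covers (cover K₂) (∈-∖⁺ e∈ (≢-sym h≢e))
  ...   | inj₁ le∈X₂ = certificate-∖ K₂ (inj₁ (subst (_∈ₛ coverˡ (cover K₂)) (sym lh≡le) le∈X₂))
  ...   | inj₂ re∈Y₂ = ⊥-elim (M₁≮M₂ M₁<M₂)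
    where
    M₁⊆Es∖h : matching K₁ ⊆ Es ∖ h
    M₁⊆Es∖h x∈ = ∈-∖⁺ (proj₁ (∈-deleteʳ⁻ {Es = Es} (matching⊆ K₁ x∈))) λ { refl → h∉M₁ x∈ }

    M₁-avoids-re : All (λ x → r x ≢ r e) (matching K₁)
    M₁-avoids-re = All.tabulate (proj₂ ∘ ∈-deleteʳ⁻ {Es = Es} ∘ matching⊆ K₁)

    M₁<M₂ : length (matching K₁) < length (matching K₂)
    M₁<M₂ with removeʳ (Cover-⊆ M₁⊆Es∖h (cover K₂)) re∈Y₂ M₁-avoids-re
    ... | C , smaller = ≤-trans (s≤s (matching≤cover (isMatching K₁) C)) (≤-trans smaller (size≤length K₂))

  -- After identifying w with v, at most one edge of a matching ends at v or w.
  fresh-right : ∀ {v w} → v ≢ w → IsMatching l (redirect w v ∘ r) M →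
                All (λ y → r y ≢ v) M ⊎ All (λ y → r y ≢ w) M
  fresh-right {r = r} {M = M} {v} {w} v≢w m with any? (λ y → r y ≟ᶠ v) M
  ... | no ¬any = inj₁ (Allₚ.¬Any⇒All¬ M ¬any)
  ... | yes any with find any
  ...   | y₀ , y₀∈ , ry₀≡v = inj₂ (All.tabulate avoids-w)
    where
    avoids-w : ∀ {y} → y ∈ M → r y ≢ w
    avoids-w {y} y∈ ry≡w with y ≟ y₀
    ... | yes refl  = v≢w (trans (sym ry₀≡v) ry≡w)
    ... | no  y≢y₀ = proj₂ (independent-∈ m y∈ y₀∈ y≢y₀)
                       (trans (redirect-onto v≢w (inj₂ ry≡w)) (sym (redirect-onto v≢w (inj₁ ry₀≡v))))

  Cover-uncontract : l f ≡ l e → (C : Cover l (redirect (r f) (r e) ∘ r) (Es ∖ e ∖ f)) →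
                     Σ[ C′ ∈ Cover l r Es ] size C′ ≤ suc (size C)
  Cover-uncontract {l = l} {f = f} {e = e} {r = r} {Es = Es} lf≡le (mkCover X Y cov) with r e ∈ₛ? Y
  ... | yes re∈Y =
    mkCover X (Y ∪ ⁅ r f ⁆) covers-Es ,
    ≤-trans (+-monoʳ-≤ ∣ X ∣ (∣p∪⁅x⁆∣≤1+∣p∣ Y (r f))) (≤-reflexive (+-suc ∣ X ∣ ∣ Y ∣))
    where
    covers-Es : ∀ {x} → x ∈ Es → l x ∈ₛ X ⊎ r x ∈ₛ Y ∪ ⁅ r f ⁆
    covers-Es {x} x∈ with x ≟ e | x ≟ f
    ... | yes refl | _        = inj₂ (x∈p⇒x∈p∪⁅y⁆ re∈Y)
    ... | no _     | yes refl = inj₂ x∈p∪⁅x⁆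
    ... | no x≢e   | no x≢f   with cov (∈-∖⁺ (∈-∖⁺ x∈ x≢e) x≢f)
    ...   | inj₁ lx∈X = inj₁ lx∈X
    ...   | inj₂ ∈Y with redirect-∈ ∈Y
    ...     | inj₁ (rx≡rf , _) = inj₂ (subst (_∈ₛ Y ∪ ⁅ r f ⁆) (sym rx≡rf) x∈p∪⁅x⁆)
    ...     | inj₂ rx∈Y        = inj₂ (x∈p⇒x∈p∪⁅y⁆ rx∈Y)
  ... | no re∉Y =
    mkCover (X ∪ ⁅ l e ⁆) Y covers-Es , +-monoˡ-≤ ∣ Y ∣ (∣p∪⁅x⁆∣≤1+∣p∣ X (l e))
    where
    covers-Es : ∀ {x} → x ∈ Es → l x ∈ₛ X ∪ ⁅ l e ⁆ ⊎ r x ∈ₛ Y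
    covers-Es {x} x∈ with x ≟ e | x ≟ f
    ... | yes refl | _        = inj₁ x∈p∪⁅x⁆
    ... | no _     | yes refl = inj₁ (subst (_∈ₛ X ∪ ⁅ l e ⁆) (sym lf≡le) x∈p∪⁅x⁆)
    ... | no x≢e   | no x≢f   with cov (∈-∖⁺ (∈-∖⁺ x∈ x≢e) x≢f)
    ...   | inj₁ lx∈X = inj₁ (x∈p⇒x∈p∪⁅y⁆ lx∈X)
    ...   | inj₂ ∈Y with redirect-∈ ∈Y
    ...     | inj₁ (_ , re∈Y) = ⊥-elim (re∉Y re∈Y)
    ...     | inj₂ rx∈Y       = inj₂ rx∈Y

  -- Contraction of a left vertex u = l e of degree two (edges e and f): a matching of the
  -- contracted graph extends by e or by f, and a cover extends by r f or by u.
  contract : e ∈ Es → f ∈ Es → l f ≡ l e → r e ≢ r f →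
             (∀ {x} → x ∈ Es → x ≢ e → x ≢ f → l x ≢ l e) →
             KönigCertificate l (redirect (r f) (r e) ∘ r) (Es ∖ e ∖ f) → KönigCertificate l r Es
  contract {e = e} {Es = Es} {f = f} {l = l} {r = r} e∈ f∈ lf≡le re≢rf degree-two K =
    Sum.[ extend-by e∈ refl , extend-by f∈ lf≡le ] (fresh-right re≢rf (isMatching K))
    where
    M⊆ : ∀ {x} → x ∈ matching K → x ∈ Es × x ≢ e × x ≢ f
    M⊆ x∈ with ∈-∖⁻ (matching⊆ K x∈)
    ... | x∈Es∖e , x≢f = Product.map₂ (_, x≢f) (∈-∖⁻ x∈Es∖e)

    extend-by : ∀ {a} → a ∈ Es → l a ≡ l e → All (λ y → r y ≢ r a) (matching K) →
                KönigCertificate l r Es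
    extend-by {a} a∈ la≡le avoids = record
      { matching    = a ∷ matching K
      ; matching⊆   = λ { (here refl) → a∈ ; (there y∈) → proj₁ (M⊆ y∈) }
      ; isMatching  = All.tabulate independent-of-a ∷
                      AllPairs.map (Product.map₂ (λ ne → ne ∘ cong (redirect (r f) (r e)))) (isMatching K)
      ; cover       = proj₁ C
      ; size≤length = ≤-trans (proj₂ C) (s≤s (size≤length K))
      }
      where
      C = Cover-uncontract {Es = Es} lf≡le (cover K)

      independent-of-a : ∀ {y} → y ∈ matching K → Independent l r a y
      independent-of-a y∈ with M⊆ y∈
      ... | y∈Es , y≢e , y≢f =
        (λ la≡ly → degree-two y∈Es y≢e y≢f (trans (sym la≡ly) la≡le)) , ≢-sym (All.lookup avoids y∈)

  independent? : ∀ (l : E → Fin p) (r : E → Fin q) e f → Dec (Independent l r e f)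
  independent? l r e f = ¬? (l e ≟ᶠ l f) ×-dec ¬? (r e ≟ᶠ r f)

  ¬independent : ¬ Independent l r e f → l e ≡ l f ⊎ r e ≡ r f
  ¬independent {l = l} {r = r} {e = e} {f = f} dep with l e ≟ᶠ l f | r e ≟ᶠ r f
  ... | yes le≡lf | _         = inj₁ le≡lf
  ... | no  _     | yes re≡rf = inj₂ re≡rf
  ... | no  le≢lf | no  re≢rf = ⊥-elim (dep (le≢lf , re≢rf))

  Conflict : (E → Fin p) → (E → Fin q) → List E → Set
  Conflict l r Es = Σ[ e ∈ E ] Σ[ f ∈ E ] (e ∈ Es × f ∈ Es × e ≢ f × (l e ≡ l f ⊎ r e ≡ r f))

  matching-or-conflict : ∀ (l : E → Fin p) (r : E → Fin q) Es → Unique Es →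
                         IsMatching l r Es ⊎ Conflict l r Es
  matching-or-conflict l r []       []               = inj₁ []
  matching-or-conflict l r (e ∷ Es) (e∉Es ∷ unique)
    with All.all? (independent? l r e) Es | matching-or-conflict l r Es unique
  ... | yes indep | inj₁ m                         = inj₁ (indep ∷ m)
  ... | yes _     | inj₂ (x , y , x∈ , y∈ , clash) = inj₂ (x , y , there x∈ , there y∈ , clash)
  ... | no ¬indep | _ with find (Allₚ.¬All⇒Any¬ (independent? l r e) Es ¬indep)
  ...   | f , f∈ , dep =
    inj₂ (e , f , here refl , there f∈ , All.lookup e∉Es f∈ , ¬independent {l = l} {r = r} dep)

  Smaller : List E → Set
  Smaller Es = ∀ {p q} (l : E → Fin p) (r : E → Fin q) Es′ → Unique Es′ →
               length Es′ < length Es → KönigCertificate l r Es′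

  certificate-without : Smaller Es → Unique Es → h ∈ Es → KönigCertificate l r (Es ∖ h)
  certificate-without smaller unique h∈ =
    smaller _ _ _ (Uniqueₚ.filter⁺ _ unique) (filter-shrinks _ h∈ λ h≢h → h≢h refl)

  degree-three : Smaller Es → Unique Es → e ∈ Es → f ∈ Es → g ∈ Es →
                 f ≢ e → g ≢ e → f ≢ g → l f ≡ l e → l g ≡ l e → KönigCertificate l r Es
  degree-three {Es = Es} {e = e} {f = f} {g = g} {l = l} {r = r}
               smaller unique e∈ f∈ g∈ f≢e g≢e f≢g lf≡le lg≡le
    with K₁ ← smaller l r (deleteʳ r (r e) Es) (Uniqueₚ.filter⁺ _ unique)
                      (filter-shrinks _ e∈ λ re≢re → re≢re refl)
    with f ∈? matching K₁ | g ∈? matching K₁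
  ... | no f∉M₁ | _         = rizzi e∈ f≢e lf≡le K₁ f∉M₁ (certificate-without smaller unique f∈)
  ... | yes _   | no g∉M₁   = rizzi e∈ g≢e lg≡le K₁ g∉M₁ (certificate-without smaller unique g∈)
  ... | yes f∈M₁ | yes g∈M₁ =
    ⊥-elim (proj₁ (independent-∈ (isMatching K₁) f∈M₁ g∈M₁ f≢g) (trans lf≡le (sym lg≡le)))

  parallel : e ∈ Es → e ≢ f → l e ≡ l f → r e ≡ r f → KönigCertificate l r (Es ∖ f) →
             KönigCertificate l r Es
  parallel e∈ e≢f le≡lf re≡rf K = certificate-∖ K
    (Sum.map (subst (_∈ₛ coverˡ (cover K)) le≡lf) (subst (_∈ₛ coverʳ (cover K)) re≡rf)
             (covers (cover K) (∈-∖⁺ e∈ e≢f)))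

  -- Two distinct edges e, f share the left vertex u = l e.  Either u has a third edge,
  -- or e and f are parallel, or u has degree two and is contracted.
  reduceˡ : Smaller Es → Unique Es → e ∈ Es → f ∈ Es → e ≢ f → l e ≡ l f → KönigCertificate l r Es
  reduceˡ {Es = Es} {e = e} {f = f} {l = l} {r = r} smaller unique e∈ f∈ e≢f le≡lf
    with any? (λ g → ¬? (g ≟ e) ×-dec ¬? (g ≟ f) ×-dec l g ≟ᶠ l e) Es
  ... | yes third with find third
  ...   | g , g∈ , g≢e , g≢f , lg≡le =
    degree-three smaller unique e∈ f∈ g∈ (≢-sym e≢f) g≢e (≢-sym g≢f) (sym le≡lf) lg≡le
  reduceˡ {Es = Es} {e = e} {f = f} {l = l} {r = r} smaller unique e∈ f∈ e≢f le≡lf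
      | no ¬third with r e ≟ᶠ r f
  ... | yes re≡rf = parallel e∈ e≢f le≡lf re≡rf (certificate-without smaller unique f∈)
  ... | no re≢rf =
    contract e∈ f∈ (sym le≡lf) re≢rf (λ x∈ x≢e x≢f lx≡le → ¬third (lose x∈ (x≢e , x≢f , lx≡le)))
      (smaller l (redirect (r f) (r e) ∘ r) (Es ∖ e ∖ f)
        (Uniqueₚ.filter⁺ _ (Uniqueₚ.filter⁺ _ unique))
        (≤-<-trans (length-filter _ (Es ∖ e)) (filter-shrinks _ e∈ λ e≢e → e≢e refl)))

  könig-bounded : ∀ k {p q} (l : E → Fin p) (r : E → Fin q) Es → Unique Es → length Es ≤ k →
                  KönigCertificate l r Es
  smaller-bounded : ∀ k → length Es ≤ k → Smaller Es

  könig-bounded k l r Es unique ∣Es∣≤k with matching-or-conflict l r Es unique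
  ... | inj₁ m = matching⇒certificate m
  ... | inj₂ (e , f , e∈ , f∈ , e≢f , inj₁ le≡lf) =
    reduceˡ (smaller-bounded {Es = Es} k ∣Es∣≤k) unique e∈ f∈ e≢f le≡lf
  ... | inj₂ (e , f , e∈ , f∈ , e≢f , inj₂ re≡rf) =
    KönigCertificate-swap (reduceˡ (smaller-bounded {Es = Es} k ∣Es∣≤k) unique e∈ f∈ e≢f re≡rf)

  smaller-bounded zero    ∣Es∣≤0  _ _ _ _ ∣Es′∣<∣Es∣ = ⊥-elim (n≮0 (≤-trans ∣Es′∣<∣Es∣ ∣Es∣≤0))
  smaller-bounded (suc k) ∣Es∣≤1+k l r Es′ unique ∣Es′∣<∣Es∣ =
    könig-bounded k l r Es′ unique (≤-pred (≤-trans ∣Es′∣<∣Es∣ ∣Es∣≤1+k))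

  könig : ∀ (l : E → Fin p) (r : E → Fin q) Es → Unique Es → KönigCertificate l r Es
  könig l r Es unique = könig-bounded (length Es) l r Es unique ≤-refl

coord : ∀ {n} → Fin 3 → Edge n → Fin n
coord zero             (x , _ , _) = x
coord (suc zero)       (_ , y , _) = y
coord (suc (suc zero)) (_ , _ , z) = z

Partite : ∀ {n} → Tripartite3Graph n → Edge n → Set
Partite H e = ∀ i → part H (coord i e) ≡ i

edge-partite : ∀ {n} (H : Tripartite3Graph n) {e} → e ∈ edges H → Partite H e
edge-partite H e∈ with All.lookup (partite H) e∈
... | p₀ , p₁ , p₂ = λ { zero → p₀ ; (suc zero) → p₁ ; (suc (suc zero)) → p₂ }

coord-part : ∀ {n} {H : Tripartite3Graph n} {e v} → Partite H e → v ∈ₑ e → coord (part H v) e ≡ v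
coord-part pe (inj₁ refl)        rewrite pe zero             = refl
coord-part pe (inj₂ (inj₁ refl)) rewrite pe (suc zero)       = refl
coord-part pe (inj₂ (inj₂ refl)) rewrite pe (suc (suc zero)) = refl

coord-meets : ∀ {n} i (e : Edge n) {S} → coord i e ∈ₛ S → Meets S e
coord-meets zero             _ = inj₁
coord-meets (suc zero)       _ = inj₂ ∘ inj₁
coord-meets (suc (suc zero)) _ = inj₂ ∘ inj₂

-- An edge e is seen in the link of part A as the pair (linkˡ A e , linkʳ A e) of its
-- two vertices outside A.
linkˡ linkʳ : ∀ {n} → Fin 3 → Edge n → Fin n
linkˡ A = coord (punchIn A zero)
linkʳ A = coord (punchIn A (suc zero))

link-independent : ∀ {n} {A} {e f : Edge n} → Independent (linkˡ A) (linkʳ A) e f →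
                   ∀ i → i ≢ A → coord i e ≢ coord i f
link-independent {A = A} (dˡ , dʳ) i i≢A with punchOut (i≢A ∘ sym) | punchIn-punchOut (i≢A ∘ sym)
... | zero     | refl = dˡ
... | suc zero | refl = dʳ

independent⇒meetOnlyIn : ∀ {n} (H : Tripartite3Graph n) {A e f} → Partite H e → Partite H f →
                         Independent (linkˡ A) (linkʳ A) e f → MeetOnlyIn H A e f
independent⇒meetOnlyIn H {A} pe pf indep v v∈e v∈f with part H v ≟ᶠ A
... | yes pv≡A = pv≡A
... | no  pv≢A = ⊥-elim (link-independent indep (part H v) pv≢A
                           (trans (coord-part {H = H} pe v∈e) (sym (coord-part {H = H} pf v∈f))))

disjoint? : ∀ {n} (T : Subset n) e → Dec (DisjointFrom T e)
disjoint? T (x , y , z) = ¬? (x ∈ₛ? T) ×-dec ¬? (y ∈ₛ? T) ×-dec ¬? (z ∈ₛ? T)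

¬disjoint⇒meets : ∀ {n} (T : Subset n) e → ¬ DisjointFrom T e → Meets T e
¬disjoint⇒meets T (x , y , z) ¬disjoint with x ∈ₛ? T | y ∈ₛ? T | z ∈ₛ? T
... | yes x∈T | _       | _       = inj₁ x∈T
... | no  _   | yes y∈T | _       = inj₂ (inj₁ y∈T)
... | no  _   | no  _   | yes z∈T = inj₂ (inj₂ z∈T)
... | no  x∉T | no  y∉T | no  z∉T = ⊥-elim (¬disjoint (x∉T , y∉T , z∉T))

meets-⊆ : ∀ {n} {S S′ : Subset n} (e : Edge n) → (∀ {v} → v ∈ₛ S → v ∈ₛ S′) → Meets S e → Meets S′ e
meets-⊆ (x , y , z) S⊆S′ = Sum.map S⊆S′ (Sum.map S⊆S′ S⊆S′)

AllPairs-zipWithAll : ∀ {A : Set} {P : A → Set} {R S : A → A → Set} →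
                      (∀ {x y} → P x → P y → R x y → S x y) →
                      ∀ {xs} → All P xs → AllPairs R xs → AllPairs S xs
AllPairs-zipWithAll f []         []         = []
AllPairs-zipWithAll f (px ∷ pxs) (rx ∷ rxs) =
  All.zipWith (λ (py , r) → f px py r) (pxs , rx) ∷ AllPairs-zipWithAll f pxs rxs

record Packing {n} (H : Tripartite3Graph n) (T : Subset n) (A : Fin 3) (F : List (Edge n)) : Set where
  constructor packing
  field
    unique     : Unique F
    ⊆edges     : All (_∈ edges H) F
    disjoint   : All (DisjointFrom T) F
    meetOnlyIn : AllPairs (MeetOnlyIn H A) F

-- König's theorem in the link of A, restricted to the edges missing T.
packing-and-cover : ∀ {n} (H : Tripartite3Graph n) (T : Subset n) (A : Fin 3) →
  Σ[ F ∈ List (Edge n) ] Packing H T A F × Σ[ S ∈ Subset n ] (IsCover H S × ∣ S ∣ ≤ ∣ T ∣ + length F)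
packing-and-cover {n} H T A =
  F , packing unique (All.tabulate (proj₁ ∘ F⊆)) (All.tabulate (proj₂ ∘ F⊆)) meetOnly ,
  T ∪ (X ∪ Y) , covers-H , ∣S∣≤∣T∣+∣F∣
  where
  _≟ₑ_ : (e f : Edge n) → Dec (e ≡ f)
  _≟ₑ_ = ≡-dec _≟ᶠ_ (≡-dec _≟ᶠ_ _≟ᶠ_)
  open Bipartite _≟ₑ_

  Es : List (Edge n)
  Es = deduplicate _≟ₑ_ (filter (disjoint? T) (edges H))

  K : KönigCertificate (linkˡ A) (linkʳ A) Es
  K = könig (linkˡ A) (linkʳ A) Es (deduplicate-! _≟ₑ_ _)
  open KönigCertificate K renaming (matching to F)
  open Cover cover renaming (coverˡ to X; coverʳ to Y)

  F⊆ : ∀ {e} → e ∈ F → e ∈ edges H × DisjointFrom T e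
  F⊆ = ∈-filter⁻ (disjoint? T) ∘ ∈-deduplicate⁻ _≟ₑ_ _ ∘ matching⊆

  unique : Unique F
  unique = AllPairs.map (λ indep e≡f → proj₁ indep (cong (linkˡ A) e≡f)) isMatching

  meetOnly : AllPairs (MeetOnlyIn H A) F
  meetOnly = AllPairs-zipWithAll (independent⇒meetOnlyIn H)
               (All.tabulate (edge-partite H ∘ proj₁ ∘ F⊆)) isMatching

  covers-H : IsCover H (T ∪ (X ∪ Y))
  covers-H {e} e∈ with disjoint? T e
  ... | no ¬disjoint = meets-⊆ e (p⊆p∪q (X ∪ Y)) (¬disjoint⇒meets T e ¬disjoint)
  ... | yes disjoint with covers (∈-deduplicate⁺ _≟ₑ_ (∈-filter⁺ (disjoint? T) e∈ disjoint))
  ...   | inj₁ ∈X = coord-meets (punchIn A zero) e (x∈p∪q⁺ (inj₂ (x∈p∪q⁺ (inj₁ ∈X))))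
  ...   | inj₂ ∈Y = coord-meets (punchIn A (suc zero)) e (x∈p∪q⁺ (inj₂ (x∈p∪q⁺ (inj₂ ∈Y))))

  ∣S∣≤∣T∣+∣F∣ : ∣ T ∪ (X ∪ Y) ∣ ≤ ∣ T ∣ + length F
  ∣S∣≤∣T∣+∣F∣ = begin
    ∣ T ∪ (X ∪ Y) ∣         ≤⟨ ∣p∪q∣≤∣p∣+∣q∣ T (X ∪ Y) ⟩
    ∣ T ∣ + ∣ X ∪ Y ∣       ≤⟨ +-monoʳ-≤ ∣ T ∣ (∣p∪q∣≤∣p∣+∣q∣ X Y) ⟩
    ∣ T ∣ + (∣ X ∣ + ∣ Y ∣) ≤⟨ +-monoʳ-≤ ∣ T ∣ size≤length ⟩
    ∣ T ∣ + length F        ∎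
    where open ≤-Reasoning

Packing-take : ∀ {n} {H : Tripartite3Graph n} {T A F} k → Packing H T A F → Packing H T A (take k F)
Packing-take k (packing unique ⊆H disjoint meetOnly) =
  packing (AllPairsₚ.take⁺ k unique) (Allₚ.take⁺ k ⊆H)
          (Allₚ.take⁺ k disjoint) (AllPairsₚ.take⁺ k meetOnly)

mainTheorem11 : ∀ {n} (H : Tripartite3Graph n) (τ : ℕ) → IsTau H τ →
    (T : Subset n) (t : ℕ) → ∣ T ∣ ≡ t → t ≤ τ → (A : Fin 3) →
    Σ[ F ∈ List (Edge n) ]
      ( Unique F
      × length F ≡ τ ∸ t
      × All (λ e → e ∈ edges H) F
      × All (DisjointFrom T) F
      × AllPairs (MeetOnlyIn H A) F )
mainTheorem11 H τ (_ , τ≤cover) T t ∣T∣≡t _ A =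
  let F , P , S , S-covers , ∣S∣≤∣T∣+∣F∣ = packing-and-cover H T A
      τ≤t+∣F∣ = ≤-trans (τ≤cover S S-covers) (subst (λ s → ∣ S ∣ ≤ s + length F) ∣T∣≡t ∣S∣≤∣T∣+∣F∣)
      packing unique ⊆H disjoint meetOnly = Packing-take (τ ∸ t) P
  in take (τ ∸ t) F , unique ,
     trans (length-take (τ ∸ t) F) (m≤n⇒m⊓n≡m (m≤n+o⇒m∸n≤o τ t τ≤t+∣F∣)) ,
     ⊆H , disjoint , meetOnly
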